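{- Let $k\geq 1$. If a graph $G$ is a sum graph over the group $(\mathbb{Z}^k,+)$, then it is a sum graph over $(\mathbb{Z},+)$. Moreover, if $G$ is a strong sum graph over $\mathbb{Z}^k$, then it is a strong sum graph over $\mathbb{Z}$.
   Context: For an abelian group $(M,+)$ and a finite subset $V\subseteq M$, $\mathcal{G}_M(V)$ is the simple graph with vertex set $V$ in which distinct $v,w$ are adjacent iff $v+w\in V$. $G$ is a sum graph over $M$ if $G\cong\mathcal{G}_M(V)$ for some $V$; it is a strong sum graph over $M$ if moreover $V$ can be chosen with $v+v\notin V$ for all $v\in V$. -}

module Defs where

open import Level using (Level; 0ℓ)
open import Data.Nat using (ℕ)
open import Data.Fin using (Fin)
open import Data.Integer using (ℤ)
import Data.Integer as ℤ
open import Data.Vec using (Vec; zipWith)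
open import Data.Product using (Σ; ∃; _×_)
open import Relation.Binary.PropositionalEquality using (_≡_)
open import Relation.Nullary using (¬_)
open import Function.Definitions using (Injective)
open import Function.Bundles using (_⇔_)

record Graph (n : ℕ) : Set₁ where
  field
    Adj   : Fin n → Fin n → Set
    sym   : ∀ {i j} → Adj i j → Adj j i
    irrefl : ∀ {i} → ¬ Adj i i

open Graph public

ℤ^ : ℕ → Set
ℤ^ k = Vec ℤ k

_+ᵥ_ : ∀ {k} → ℤ^ k → ℤ^ k → ℤ^ k
_+ᵥ_ = zipWith ℤ._+_

InImage : ∀ {M : Set} {n : ℕ} → (Fin n → M) → M → Set
InImage f x = ∃ λ l → f l ≡ x

-- G ≅ 𝒢_M(V): V is the image of an injective labelling f : Fin n → M
-- (so f : Fin n → V is the isomorphism), and distinct i, j are adjacent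
-- iff f i + f j ∈ V.
IsSumLabelling : ∀ {M : Set} (_+_ : M → M → M) {n : ℕ} → Graph n → (Fin n → M) → Set
IsSumLabelling _+_ G f =
  Injective _≡_ _≡_ f ×
  (∀ i j → ¬ i ≡ j → (Adj G i j ⇔ InImage f (f i + f j)))

IsSumGraph : ∀ (M : Set) (_+_ : M → M → M) {n : ℕ} → Graph n → Set
IsSumGraph M _+_ G = Σ (_ → M) λ f → IsSumLabelling _+_ G f

IsStrongSumGraph : ∀ (M : Set) (_+_ : M → M → M) {n : ℕ} → Graph n → Set
IsStrongSumGraph M _+_ G = Σ (_ → M) λ f →
  IsSumLabelling _+_ G f × (∀ i → ¬ InImage f (f i + f i))

{-# OPTIONS --safe #-}
-- Reading a vector as base-B digits, x ↦ Σᵢ xᵢ Bⁱ, is a homomorphism ℤ^k → ℤ, and it is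
-- injective on pairs of vectors whose ℓ¹-norms add up to less than B.  A labelling
-- V ⊆ ℤ^k of a sum graph involves only the finitely many vectors of V ∪ (V + V), so for B
-- large enough the digit map identifies none of the relevant pairs and carries V to a set of
-- integers with exactly the same sums inside it (and, for strong labellings, outside it).
module Submission where

open import Defs
open import Data.Nat using (ℕ; _≤_)
open import Data.Integer using (ℤ; _+_)
open import Data.Product using (_×_)

open import Algebra.Properties.CommutativeSemigroup using (interchange)
open import Data.Fin using (Fin; zero; suc)
import Data.Integer as ℤ
import Data.Integer.Properties as ℤ
open import Data.Integer.Solver using (module +-*-Solver)
import Data.Nat as ℕ
import Data.Nat.Properties as ℕ
open import Data.Product using (_,_; proj₁; proj₂; ∃-syntax)
open import Data.Vec using ([]; _∷_)
open import Function.Base using (_∘_)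
open import Function.Bundles using (mk⇔; Equivalence)
open import Relation.Binary.PropositionalEquality
  using (_≡_; refl; trans; cong; cong₂; subst; module ≡-Reasoning)
import Relation.Binary.PropositionalEquality as ≡
open import Relation.Nullary using (contradiction)

Separates : ∀ {M N : Set} (_+ᴹ_ : M → M → M) (h : M → N) {n : ℕ} (f : Fin n → M) → Set
Separates _+ᴹ_ h f = (∀ i j → h (f i) ≡ h (f j) → f i ≡ f j) ×
                     (∀ l i j → h (f l) ≡ h (f i +ᴹ f j) → f l ≡ f i +ᴹ f j)

module Transport {M N : Set} (_+ᴹ_ : M → M → M) (_+ᴺ_ : N → N → N)
         (h : M → N) (h-+ : ∀ x y → h (x +ᴹ y) ≡ h x +ᴺ h y)
         {n : ℕ} (f : Fin n → M) where

  InImage-sum-map : ∀ {i j} → InImage f (f i +ᴹ f j) → InImage (h ∘ f) (h (f i) +ᴺ h (f j))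
  InImage-sum-map {i} {j} (l , fl≡) = l , trans (cong h fl≡) (h-+ (f i) (f j))

  InImage-sum-reflect : Separates _+ᴹ_ h f → ∀ {i j} →
                        InImage (h ∘ f) (h (f i) +ᴺ h (f j)) → InImage f (f i +ᴹ f j)
  InImage-sum-reflect (_ , on-sums) {i} {j} (l , hfl≡) =
    l , on-sums l i j (trans hfl≡ (≡.sym (h-+ (f i) (f j))))

  IsSumLabelling-map : (G : Graph n) → Separates _+ᴹ_ h f →
                       IsSumLabelling _+ᴹ_ G f → IsSumLabelling _+ᴺ_ G (h ∘ f)
  IsSumLabelling-map G sep@(on-labels , _) (f-injective , adj⇔) =
    (λ {i} {j} → f-injective ∘ on-labels i j) ,
    λ i j i≢j → mk⇔ (InImage-sum-map ∘ Equivalence.to (adj⇔ i j i≢j))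
                    (Equivalence.from (adj⇔ i j i≢j) ∘ InImage-sum-reflect sep)

bounded : ∀ {n} (g : Fin n → ℕ) → ∃[ m ] (∀ l → g l ≤ m)
bounded {ℕ.zero} g = 0 , λ ()
bounded {ℕ.suc n} g with bounded (g ∘ suc)
... | m , g∘suc≤m = g zero ℕ.⊔ m , λ where
  zero    → ℕ.m≤m⊔n (g zero) m
  (suc l) → ℕ.m≤n⇒m≤o⊔n (g zero) (g∘suc≤m l)

m*n<m⇒n≡0 : ∀ m n → m ℕ.* n ℕ.< m → n ≡ 0
m*n<m⇒n≡0 m ℕ.zero    _  = refl
m*n<m⇒n≡0 m (ℕ.suc n) lt = contradiction lt (ℕ.≤⇒≯ (ℕ.m≤m*n m (ℕ.suc n)))

digit-unique : ∀ B {x y p q : ℤ} → x + ℤ.+ B ℤ.* p ≡ y + ℤ.+ B ℤ.* q →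
               ℤ.∣ x ℤ.- y ∣ ℕ.< B → x ≡ y × p ≡ q
digit-unique B {x} {y} {p} {q} eq ∣x-y∣<B = x≡y , ≡.sym (ℤ.i-j≡0⇒i≡j q p q-p≡0)
  where
  open +-*-Solver
  b : ℤ
  b = ℤ.+ B
  x-y≡ : x ℤ.- y ≡ b ℤ.* (q ℤ.- p)
  x-y≡ = begin
    x ℤ.- y
      ≡⟨ solve 4 (λ x y b p → x :- y := ((x :+ b :* p) :- y) :- b :* p) refl x y b p ⟩
    ((x + b ℤ.* p) ℤ.- y) ℤ.- b ℤ.* p
      ≡⟨ cong (λ t → (t ℤ.- y) ℤ.- b ℤ.* p) eq ⟩
    ((y + b ℤ.* q) ℤ.- y) ℤ.- b ℤ.* p
      ≡⟨ solve 4 (λ y b p q → ((y :+ b :* q) :- y) :- b :* p := b :* (q :- p)) refl y b p q ⟩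
    b ℤ.* (q ℤ.- p) ∎
    where open ≡-Reasoning
  q-p≡0 : q ℤ.- p ≡ ℤ.+ 0
  q-p≡0 = ℤ.∣i∣≡0⇒i≡0 (m*n<m⇒n≡0 B ℤ.∣ q ℤ.- p ∣
            (subst (ℕ._< B) (trans (cong ℤ.∣_∣ x-y≡) (ℤ.abs-* b (q ℤ.- p))) ∣x-y∣<B))
  x≡y : x ≡ y
  x≡y = ℤ.i-j≡0⇒i≡j x y (trans x-y≡ (trans (cong (b ℤ.*_) q-p≡0) (ℤ.*-zeroʳ b)))

fromDigits : ℕ → ∀ {k} → ℤ^ k → ℤ
fromDigits B []       = ℤ.+ 0
fromDigits B (x ∷ xs) = x + ℤ.+ B ℤ.* fromDigits B xs

norm₁ : ∀ {k} → ℤ^ k → ℕ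
norm₁ []       = 0
norm₁ (x ∷ xs) = ℤ.∣ x ∣ ℕ.+ norm₁ xs

norm₁-+ᵥ : ∀ {k} (x y : ℤ^ k) → norm₁ (x +ᵥ y) ≤ norm₁ x ℕ.+ norm₁ y
norm₁-+ᵥ []       []       = ℕ.z≤n
norm₁-+ᵥ (x ∷ xs) (y ∷ ys) = begin
  ℤ.∣ x + y ∣ ℕ.+ norm₁ (xs +ᵥ ys)
    ≤⟨ ℕ.+-mono-≤ (ℤ.∣i+j∣≤∣i∣+∣j∣ x y) (norm₁-+ᵥ xs ys) ⟩
  (ℤ.∣ x ∣ ℕ.+ ℤ.∣ y ∣) ℕ.+ (norm₁ xs ℕ.+ norm₁ ys)
    ≡⟨ interchange ℕ.+-commutativeSemigroup ℤ.∣ x ∣ ℤ.∣ y ∣ (norm₁ xs) (norm₁ ys) ⟩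
  (ℤ.∣ x ∣ ℕ.+ norm₁ xs) ℕ.+ (ℤ.∣ y ∣ ℕ.+ norm₁ ys) ∎
  where open ℕ.≤-Reasoning

fromDigits-+ᵥ : ∀ B {k} (x y : ℤ^ k) → fromDigits B (x +ᵥ y) ≡ fromDigits B x + fromDigits B y
fromDigits-+ᵥ B []       []       = refl
fromDigits-+ᵥ B (x ∷ xs) (y ∷ ys) = begin
  (x + y) + b ℤ.* fromDigits B (xs +ᵥ ys)
    ≡⟨ cong (λ t → (x + y) + b ℤ.* t) (fromDigits-+ᵥ B xs ys) ⟩
  (x + y) + b ℤ.* (p + q)
    ≡⟨ cong ((x + y) +_) (ℤ.*-distribˡ-+ b p q) ⟩
  (x + y) + (b ℤ.* p + b ℤ.* q)
    ≡⟨ interchange ℤ.+-commutativeSemigroup x y (b ℤ.* p) (b ℤ.* q) ⟩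
  (x + b ℤ.* p) + (y + b ℤ.* q) ∎
  where
  open ≡-Reasoning
  b : ℤ
  b = ℤ.+ B
  p q : ℤ
  p = fromDigits B xs
  q = fromDigits B ys

fromDigits-injective : ∀ B {k} (x y : ℤ^ k) → norm₁ x ℕ.+ norm₁ y ℕ.< B →
                       fromDigits B x ≡ fromDigits B y → x ≡ y
fromDigits-injective B []       []       _     _  = refl
fromDigits-injective B (x ∷ xs) (y ∷ ys) small eq =
  cong₂ _∷_ (proj₁ digits≡) (fromDigits-injective B xs ys tails-small (proj₂ digits≡))
  where
  split : (ℤ.∣ x ∣ ℕ.+ ℤ.∣ y ∣) ℕ.+ (norm₁ xs ℕ.+ norm₁ ys) ℕ.< B
  split = subst (ℕ._< B)
    (≡.sym (interchange ℕ.+-commutativeSemigroup ℤ.∣ x ∣ ℤ.∣ y ∣ (norm₁ xs) (norm₁ ys))) small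
  tails-small : norm₁ xs ℕ.+ norm₁ ys ℕ.< B
  tails-small = ℕ.≤-<-trans (ℕ.m≤n+m (norm₁ xs ℕ.+ norm₁ ys) (ℤ.∣ x ∣ ℕ.+ ℤ.∣ y ∣)) split
  digits≡ : x ≡ y × fromDigits B xs ≡ fromDigits B ys
  digits≡ = digit-unique B eq (ℕ.≤-<-trans (ℤ.∣i-j∣≤∣i∣+∣j∣ x y) (ℕ.m+n≤o⇒m≤o _ split))

fromDigits-separates : ∀ {k n} (f : Fin n → ℤ^ k) → ∃[ B ] Separates _+ᵥ_ (fromDigits B) f
fromDigits-separates f with bounded (norm₁ ∘ f)
... | m , ∣f∣≤m = B , on-labels , on-sums
  where
  B : ℕ
  B = ℕ.suc (m ℕ.+ (m ℕ.+ m))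
  on-labels : ∀ i j → fromDigits B (f i) ≡ fromDigits B (f j) → f i ≡ f j
  on-labels i j = fromDigits-injective B (f i) (f j) (ℕ.s≤s (begin
    norm₁ (f i) ℕ.+ norm₁ (f j) ≤⟨ ℕ.+-mono-≤ (∣f∣≤m i) (∣f∣≤m j) ⟩
    m ℕ.+ m                     ≤⟨ ℕ.m≤n+m (m ℕ.+ m) m ⟩
    m ℕ.+ (m ℕ.+ m)             ∎))
    where open ℕ.≤-Reasoning
  on-sums : ∀ l i j → fromDigits B (f l) ≡ fromDigits B (f i +ᵥ f j) → f l ≡ f i +ᵥ f j
  on-sums l i j = fromDigits-injective B (f l) (f i +ᵥ f j) (ℕ.s≤s (ℕ.+-mono-≤ (∣f∣≤m l) (begin
    norm₁ (f i +ᵥ f j)          ≤⟨ norm₁-+ᵥ (f i) (f j) ⟩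
    norm₁ (f i) ℕ.+ norm₁ (f j) ≤⟨ ℕ.+-mono-≤ (∣f∣≤m i) (∣f∣≤m j) ⟩
    m ℕ.+ m                     ∎)))
    where open ℕ.≤-Reasoning

-- The argument works verbatim for k = 0.
mainTheorem12 : (k : ℕ) → 1 ≤ k → (n : ℕ) → (G : Graph n) →
    (IsSumGraph (ℤ^ k) _+ᵥ_ G → IsSumGraph ℤ _+_ G) ×
    (IsStrongSumGraph (ℤ^ k) _+ᵥ_ G → IsStrongSumGraph ℤ _+_ G)
mainTheorem12 k _ n G = sumGraph , strongSumGraph
  where
  open Transport _+ᵥ_ _+_
  sumGraph : IsSumGraph (ℤ^ k) _+ᵥ_ G → IsSumGraph ℤ _+_ G
  sumGraph (f , labelling) with fromDigits-separates f
  ... | B , sep = fromDigits B ∘ f ,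
    IsSumLabelling-map (fromDigits B) (fromDigits-+ᵥ B) f G sep labelling
  strongSumGraph : IsStrongSumGraph (ℤ^ k) _+ᵥ_ G → IsStrongSumGraph ℤ _+_ G
  strongSumGraph (f , labelling , no-doubles) with fromDigits-separates f
  ... | B , sep = fromDigits B ∘ f ,
    IsSumLabelling-map (fromDigits B) (fromDigits-+ᵥ B) f G sep labelling ,
    λ i → no-doubles i ∘ InImage-sum-reflect (fromDigits B) (fromDigits-+ᵥ B) f sep
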